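{- For $N\in \mathbb{N}$, we have \begin{align*} \frac{(-a q)_N (be)_N}{(b q)_N}=\sum_{n=0}^{N} \begin{bmatrix} N \\ n \end{bmatrix}_q \frac{ (-1)^n (-ae)_{N-n} (-b/a)_n (q/e)_n (ae)^{n}}{(b q)_{n}}. \end{align*}
   Context: Let $q$ be a complex number with $|q|<1$, and $a,b,e$ complex numbers (with $a\neq 0$ and denominators nonzero). The $q$-Pochhammer symbol is $(x)_0=(x;q)_0=1$, $(x)_n=(x;q)_n=(1-x)(1-xq)\cdots(1-xq^{n-1})$ for $n\geq 1$, and $(x)_\infty=\lim_{n\to\infty}(x)_n$. The $q$-binomial coefficient is $\begin{bmatrix} N \\ n \end{bmatrix}_q=\frac{(q;q)_N}{(q;q)_n(q;q)_{N-n}}$ for $0\le n\le N$ and $0$ otherwise. -}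

module Defs where

open import Level using (Level; _⊔_) renaming (suc to lsuc)
open import Algebra.Bundles using (CommutativeRing)
open import Data.Nat as ℕ using (ℕ; zero; suc; _∸_; _≤?_)
open import Data.Fin using (Fin; zero; suc)
open import Relation.Nullary using (¬_; yes; no)

record Field (c ℓ : Level) : Set (lsuc (c ⊔ ℓ)) where
  field
    commutativeRing : CommutativeRing c ℓ
  open CommutativeRing commutativeRing public
  field
    1≉0         : ¬ (1# ≈ 0#)
    inv         : (x : Carrier) → ¬ (x ≈ 0#) → Carrier
    inv-inverse : ∀ x (p : ¬ (x ≈ 0#)) → x * inv x p ≈ 1#

module FieldOps {c ℓ : Level} (F : Field c ℓ) where
  open Field F using (Carrier; _≈_; _+_; _*_; _-_; 0#; 1#; inv)

  pow : Carrier → ℕ → Carrier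
  pow x zero    = 1#
  pow x (suc n) = pow x n * x

  poch : Carrier → Carrier → ℕ → Carrier
  poch q x zero    = 1#
  poch q x (suc n) = poch q x n * (1# - x * pow q n)

  sumFin : (n : ℕ) → (Fin n → Carrier) → Carrier
  sumFin zero    f = 0#
  sumFin (suc n) f = f zero + sumFin n (λ i → f (suc i))

  qbinom : (q : Carrier) → (∀ k → ¬ (poch q q k ≈ 0#)) → ℕ → ℕ → Carrier
  qbinom q hq N n with n ≤? N
  ... | yes _ = poch q q N * inv (poch q q n) (hq n) * inv (poch q q (N ∸ n)) (hq (N ∸ n))
  ... | no  _ = 0#

{-# OPTIONS --safe #-}
-- Put c = -a and multiply by (bq;q)_N.  Since (bq;q)_N / (bq;q)_n = (bq^{n+1};q)_{N-n} and
-- (-1)^n (-b/a;q)_n (q/e;q)_n (ae)^n = w_n := Π_{j<n} (c - bq^j)(e - q^{j+1}), the theorem becomes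
-- the polynomial identity
--   (cq;q)_N (be;q)_N = Σ_{n+m=N} [n+m, n]_q (ce;q)_m (bq^{n+1};q)_m w_n .
-- Both sides get multiplied by ρ_N = (1 - cq^{N+1})(1 - beq^N) when N increases: for the right
-- side this is creative telescoping along antidiagonals, with the Gaussian coefficient split by
-- q-Pascal and the certificate H(n,m) = -q^m [n+m, n]_q (ce;q)_m (bq^{n+1};q)_m w_{n+1}.
module Submission where

open import Defs
open import Level using (Level)
open import Data.Nat using (ℕ; suc; _≤_; _∸_)
open import Data.Nat.Properties using (≤-refl)
open import Data.Fin using (Fin; toℕ)
open import Data.Fin.Properties using (toℕ≤pred[n])
open import Relation.Nullary using (¬_)

open import Algebra.Bundles using (CommutativeRing)
open import Algebra.Solver.Ring.AlmostCommutativeRing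
  using (fromCommutativeRing; _-Raw-AlmostCommutative⟶_)
open import Data.Empty using (⊥-elim)
open import Data.Fin using (zero; suc)
open import Data.Integer.Base as ℤ using (ℤ; +_; -[1+_]; _⊖_; sign; ∣_∣; _◃_)
open import Data.Integer.Properties using ([1+m]⊖[1+n]≡m⊖n) renaming (_≟_ to _≟ℤ_)
open import Data.Maybe.Base using (Maybe; map)
open import Data.Nat as ℕ using (zero; _≤?_)
import Data.Nat.Properties as ℕₚ
open import Data.Sign.Base as Sign using (Sign)
open import Relation.Binary.Consequences using (dec⇒weaklyDec)
open import Relation.Binary.PropositionalEquality.Core as ≡ using (_≡_)
open import Relation.Nullary using (yes; no)

-- Tactic.RingSolver takes its coefficients from the ring itself, where it cannot recognise 1# - 1#
-- as 0#, and the natural-coefficient solver has no negation; so Algebra.Solver.Ring is instantiated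
-- with coefficients in ℤ.
module IntegerCoefficients {ℓ₁ ℓ₂} (R : CommutativeRing ℓ₁ ℓ₂) where
  open CommutativeRing R
  open import Algebra.Properties.Ring ring using (-1*x≈-x)
  open import Algebra.Properties.Group +-group using (ε⁻¹≈ε; ⁻¹-involutive)
  open import Algebra.Properties.AbelianGroup +-abelianGroup using (⁻¹-∙-comm)
  open import Algebra.Properties.CommutativeSemigroup +-commutativeSemigroup
    using () renaming (interchange to +-interchange)
  open import Algebra.Properties.CommutativeSemigroup *-commutativeSemigroup
    using () renaming (interchange to *-interchange)
  open import Algebra.Properties.Semiring.Mult.TCOptimised semiring
    using (_×_; 1+×; ×-homo-+; ×1-homo-*)
  open import Relation.Binary.Reasoning.Setoid setoid

  -- With the optimised _×_, ι (+ 1) reduces to 1#, so solver constants match goals definitionally.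
  ι : ℤ → Carrier
  ι (+ n)    = n × 1#
  ι -[1+ n ] = - (suc n × 1#)

  private
    ι-⊖ : ∀ m n → ι (m ⊖ n) ≈ m × 1# - n × 1#
    ι-⊖ m       zero    = sym (trans (+-congˡ ε⁻¹≈ε) (+-identityʳ _))
    ι-⊖ zero    (suc n) = sym (+-identityˡ _)
    ι-⊖ (suc m) (suc n) = begin
      ι (suc m ⊖ suc n)        ≡⟨ ≡.cong ι ([1+m]⊖[1+n]≡m⊖n m n) ⟩
      ι (m ⊖ n)                ≈⟨ ι-⊖ m n ⟩
      M - N                    ≈⟨ +-identityˡ _ ⟨
      0# + (M - N)             ≈⟨ +-congʳ (-‿inverseʳ 1#) ⟨
      (1# - 1#) + (M - N)      ≈⟨ +-interchange _ _ _ _ ⟩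
      (1# + M) + (- 1# - N)    ≈⟨ +-congˡ (⁻¹-∙-comm 1# N) ⟩
      (1# + M) - (1# + N)      ≈⟨ +-cong (1+× m 1#) (-‿cong (1+× n 1#)) ⟨
      suc m × 1# - suc n × 1#  ∎
      where M = m × 1#; N = n × 1#

    ι-+ : ∀ i j → ι (i ℤ.+ j) ≈ ι i + ι j
    ι-+ -[1+ m ] -[1+ n ] = begin
      - (suc (suc (m ℕ.+ n)) × 1#)   ≡⟨ ≡.cong (λ k → - (k × 1#)) (ℕₚ.+-suc (suc m) n) ⟨
      - ((suc m ℕ.+ suc n) × 1#)     ≈⟨ -‿cong (×-homo-+ 1# (suc m) (suc n)) ⟩
      - (suc m × 1# + suc n × 1#)    ≈⟨ ⁻¹-∙-comm _ _ ⟨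
      - (suc m × 1#) - (suc n × 1#)  ∎
    ι-+ -[1+ m ] (+ n)    = trans (ι-⊖ n (suc m)) (+-comm _ _)
    ι-+ (+ m)    -[1+ n ] = ι-⊖ m (suc n)
    ι-+ (+ m)    (+ n)    = ×-homo-+ 1# m n

    σ : Sign → Carrier
    σ Sign.+ = 1#
    σ Sign.- = - 1#

    σ-* : ∀ s t → σ (s Sign.* t) ≈ σ s * σ t
    σ-* Sign.- Sign.- = sym (trans (-1*x≈-x (- 1#)) (⁻¹-involutive 1#))
    σ-* Sign.- Sign.+ = sym (*-identityʳ _)
    σ-* Sign.+ _      = sym (*-identityˡ _)

    ι-◃ : ∀ s n → ι (s ◃ n) ≈ σ s * (n × 1#)
    ι-◃ s      zero    = sym (zeroʳ _)
    ι-◃ Sign.+ (suc n) = sym (*-identityˡ _)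
    ι-◃ Sign.- (suc n) = sym (-1*x≈-x _)

    ι≈sign*abs : ∀ i → ι i ≈ σ (sign i) * (∣ i ∣ × 1#)
    ι≈sign*abs (+ n)    = sym (*-identityˡ _)
    ι≈sign*abs -[1+ n ] = sym (-1*x≈-x _)

    ι-* : ∀ i j → ι (i ℤ.* j) ≈ ι i * ι j
    ι-* i j = begin
      ι (s ◃ (∣ i ∣ ℕ.* ∣ j ∣))
        ≈⟨ ι-◃ s (∣ i ∣ ℕ.* ∣ j ∣) ⟩
      σ s * ((∣ i ∣ ℕ.* ∣ j ∣) × 1#)
        ≈⟨ *-cong (σ-* (sign i) (sign j)) (×1-homo-* ∣ i ∣ ∣ j ∣) ⟩
      (σ (sign i) * σ (sign j)) * (∣ i ∣ × 1# * ∣ j ∣ × 1#)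
        ≈⟨ *-interchange _ _ _ _ ⟩
      (σ (sign i) * ∣ i ∣ × 1#) * (σ (sign j) * ∣ j ∣ × 1#)
        ≈⟨ *-cong (ι≈sign*abs i) (ι≈sign*abs j) ⟨
      ι i * ι j
        ∎
      where s = sign i Sign.* sign j

    ι-neg : ∀ i → ι (ℤ.- i) ≈ - ι i
    ι-neg (+ zero)  = sym ε⁻¹≈ε
    ι-neg (+ suc n) = refl
    ι-neg -[1+ n ]  = sym (⁻¹-involutive _)

  ι-homomorphism : ℤ.+-*-rawRing -Raw-AlmostCommutative⟶ fromCommutativeRing R
  ι-homomorphism = record
    { ⟦_⟧ = ι ; +-homo = ι-+ ; *-homo = ι-* ; -‿homo = ι-neg ; 0-homo = refl ; 1-homo = refl }

  private
    ≡⇒ι≈ : ∀ {i j} → i ≡ j → ι i ≈ ι j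
    ≡⇒ι≈ ≡.refl = refl

    ι≈-weaklyDecidable : ∀ i j → Maybe (ι i ≈ ι j)
    ι≈-weaklyDecidable i j = map ≡⇒ι≈ (dec⇒weaklyDec _≟ℤ_ i j)

  open import Algebra.Solver.Ring ℤ.+-*-rawRing (fromCommutativeRing R) ι-homomorphism ι≈-weaklyDecidable
    using (Polynomial; con; _:+_; _:*_; _:-_; :-_; solve; _:=_) public

  :1 : ∀ {n} → Polynomial n
  :1 = con (+ 1)

module QSeries {ℓ₁ ℓ₂} (F : Field ℓ₁ ℓ₂) where
  open Field F hiding (zero)
  open FieldOps F
  open IntegerCoefficients commutativeRing
  open import Algebra.Properties.CommutativeSemigroup *-commutativeSemigroup using (xy∙z≈xz∙y)
  open import Algebra.Properties.Group +-group using (ε⁻¹≈ε; x≈y⇒x∙y⁻¹≈ε)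
  open import Algebra.Properties.Ring ring using (-‿distribˡ-*)
  open import Relation.Binary.Reasoning.Setoid setoid

  inv-inverseˡ : ∀ x (p : ¬ (x ≈ 0#)) → inv x p * x ≈ 1#
  inv-inverseˡ x p = trans (*-comm _ _) (inv-inverse x p)

  *-inv-cancelʳ : ∀ x z (p : ¬ (z ≈ 0#)) → x * z * inv z p ≈ x
  *-inv-cancelʳ x z p = begin
    x * z * inv z p    ≈⟨ *-assoc x z _ ⟩
    x * (z * inv z p)  ≈⟨ *-congˡ (inv-inverse z p) ⟩
    x * 1#             ≈⟨ *-identityʳ x ⟩
    x                  ∎

  *-cancelʳ : ∀ {x y} z → ¬ (z ≈ 0#) → x * z ≈ y * z → x ≈ y
  *-cancelʳ {x} {y} z p xz≈yz = begin
    x                ≈⟨ *-inv-cancelʳ x z p ⟨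
    x * z * inv z p  ≈⟨ *-congʳ xz≈yz ⟩
    y * z * inv z p  ≈⟨ *-inv-cancelʳ y z p ⟩
    y                ∎

  inv-factor : ∀ {x r y} (p : ¬ (x ≈ 0#)) (p′ : ¬ (y ≈ 0#)) → y ≈ x * r → inv x p ≈ r * inv y p′
  inv-factor {x} {r} {y} p p′ y≈xr = begin
    inv x p                       ≈⟨ *-identityʳ _ ⟨
    inv x p * 1#                  ≈⟨ *-congˡ (inv-inverse y p′) ⟨
    inv x p * (y * inv y p′)      ≈⟨ *-congˡ (trans (*-congʳ y≈xr) (*-assoc x r _)) ⟩
    inv x p * (x * (r * inv y p′))  ≈⟨ *-assoc _ x _ ⟨
    inv x p * x * (r * inv y p′)  ≈⟨ *-congʳ (inv-inverseˡ x p) ⟩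
    1# * (r * inv y p′)           ≈⟨ *-identityˡ _ ⟩
    r * inv y p′                  ∎

  pow-+ : ∀ x m n → pow x (m ℕ.+ n) ≈ pow x m * pow x n
  pow-+ x zero    n = sym (*-identityˡ _)
  pow-+ x (suc m) n = trans (*-congʳ (pow-+ x m n)) (xy∙z≈xz∙y _ _ _)

  poch-cong : ∀ q {x y} n → x ≈ y → poch q x n ≈ poch q y n
  poch-cong q zero    x≈y = refl
  poch-cong q (suc n) x≈y = *-cong (poch-cong q n x≈y) (+-congˡ (-‿cong (*-congʳ x≈y)))

  poch-+ : ∀ q x m n → poch q x (m ℕ.+ n) ≈ poch q x m * poch q (x * pow q m) n
  poch-+ q x m zero = begin
    poch q x (m ℕ.+ 0)  ≡⟨ ≡.cong (poch q x) (ℕₚ.+-identityʳ m) ⟩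
    poch q x m          ≈⟨ *-identityʳ _ ⟨
    poch q x m * 1#     ∎
  poch-+ q x m (suc n) = begin
    poch q x (m ℕ.+ suc n)
      ≡⟨ ≡.cong (poch q x) (ℕₚ.+-suc m n) ⟩
    poch q x (m ℕ.+ n) * (1# - x * pow q (m ℕ.+ n))
      ≈⟨ *-cong (poch-+ q x m n) (+-congˡ (-‿cong x*qᵐ⁺ⁿ)) ⟩
    poch q x m * poch q (x * pow q m) n * (1# - x * pow q m * pow q n)
      ≈⟨ *-assoc _ _ _ ⟩
    poch q x m * poch q (x * pow q m) (suc n)
      ∎
    where
    x*qᵐ⁺ⁿ : x * pow q (m ℕ.+ n) ≈ x * pow q m * pow q n
    x*qᵐ⁺ⁿ = trans (*-congˡ (pow-+ q m n)) (sym (*-assoc _ _ _))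

  poch-suc : ∀ q x n → poch q x (suc n) ≈ (1# - x) * poch q (x * q) n
  poch-suc q x n = begin
    poch q x (1 ℕ.+ n)
      ≈⟨ poch-+ q x 1 n ⟩
    1# * (1# - x * 1#) * poch q (x * (1# * q)) n
      ≈⟨ *-cong 1-x (poch-cong q n (*-congˡ (*-identityˡ q))) ⟩
    (1# - x) * poch q (x * q) n
      ∎
    where
    1-x : 1# * (1# - x * 1#) ≈ 1# - x
    1-x = trans (*-identityˡ _) (+-congˡ (-‿cong (*-identityʳ x)))

  sumFin-cong : ∀ n {f g : Fin n → Carrier} → (∀ i → f i ≈ g i) → sumFin n f ≈ sumFin n g
  sumFin-cong zero    f≈g = refl
  sumFin-cong (suc n) f≈g = +-cong (f≈g zero) (sumFin-cong n (λ i → f≈g (suc i)))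

  sumFin-distribʳ : ∀ n (f : Fin n → Carrier) z → sumFin n f * z ≈ sumFin n (λ i → f i * z)
  sumFin-distribʳ zero    f z = zeroˡ z
  sumFin-distribʳ (suc n) f z =
    trans (distribʳ z _ _) (+-congˡ (sumFin-distribʳ n (λ i → f (suc i)) z))

  sumAntidiagonal : ℕ → (ℕ → ℕ → Carrier) → Carrier
  sumAntidiagonal N f = sumFin (suc N) (λ i → f (toℕ i) (N ∸ toℕ i))

  -- Shifting U, H, ρ by one in the first index moves the defect H 0 (suc m) onto the left boundary,
  -- hence the generalisation by K.
  sumAntidiagonal-telescope : (U H : ℕ → ℕ → Carrier) (ρ K : ℕ → Carrier) →
    (∀ m → U 0 (suc m) ≈ ρ m * U 0 m + (H 0 m - K m)) →
    (∀ n → U (suc n) 0 ≈ - H n 0) →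
    (∀ n m → U (suc n) (suc m) ≈ ρ (suc (n ℕ.+ m)) * U (suc n) m + (H (suc n) m - H n (suc m))) →
    ∀ N → sumAntidiagonal (suc N) U ≈ ρ N * sumAntidiagonal N U - K N
  sumAntidiagonal-telescope U H ρ K left right interior zero = begin
    U 0 1 + (U 1 0 + 0#)
      ≈⟨ +-cong (left 0) (+-congʳ (right 0)) ⟩
    ρ 0 * U 0 0 + (H 0 0 - K 0) + (- H 0 0 + 0#)
      ≈⟨ solve 4 (λ r u h k → r :* u :+ (h :- k) :+ (:- h :+ con (+ 0)) := r :* (u :+ con (+ 0)) :- k)
                 refl (ρ 0) (U 0 0) (H 0 0) (K 0) ⟩
    ρ 0 * (U 0 0 + 0#) - K 0
      ∎
  sumAntidiagonal-telescope U H ρ K left right interior (suc N) = begin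
    U 0 (suc (suc N)) + sumAntidiagonal (suc N) U′
      ≈⟨ +-cong (left (suc N)) (sumAntidiagonal-telescope U′ (λ n → H (suc n)) ρ′ (λ m → H 0 (suc m))
                                  (interior 0) (λ n → right (suc n)) (λ n → interior (suc n)) N) ⟩
    ρ′ N * U 0 (suc N) + (H 0 (suc N) - K (suc N)) + (ρ′ N * sumAntidiagonal N U′ - H 0 (suc N))
      ≈⟨ solve 5 (λ r u s h k → r :* u :+ (h :- k) :+ (r :* s :- h) := r :* (u :+ s) :- k)
                 refl (ρ′ N) (U 0 (suc N)) (sumAntidiagonal N U′) (H 0 (suc N)) (K (suc N)) ⟩
    ρ′ N * (U 0 (suc N) + sumAntidiagonal N U′) - K (suc N)
      ∎
    where
    U′ : ℕ → ℕ → Carrier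
    U′ n = U (suc n)
    ρ′ : ℕ → Carrier
    ρ′ n = ρ (suc n)

  sumAntidiagonal-recurrence : (U H : ℕ → ℕ → Carrier) (ρ : ℕ → Carrier) →
    (∀ m → U 0 (suc m) ≈ ρ m * U 0 m + H 0 m) →
    (∀ n → U (suc n) 0 ≈ - H n 0) →
    (∀ n m → U (suc n) (suc m) ≈ ρ (suc (n ℕ.+ m)) * U (suc n) m + (H (suc n) m - H n (suc m))) →
    ∀ N → sumAntidiagonal (suc N) U ≈ ρ N * sumAntidiagonal N U
  sumAntidiagonal-recurrence U H ρ left right interior N = begin
    sumAntidiagonal (suc N) U       ≈⟨ sumAntidiagonal-telescope U H ρ (λ _ → 0#) left′ right interior N ⟩
    ρ N * sumAntidiagonal N U - 0#  ≈⟨ x-0≈x _ ⟩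
    ρ N * sumAntidiagonal N U       ∎
    where
    x-0≈x : ∀ x → x - 0# ≈ x
    x-0≈x x = trans (+-congˡ ε⁻¹≈ε) (+-identityʳ x)
    left′ : ∀ m → U 0 (suc m) ≈ ρ m * U 0 m + (H 0 m - 0#)
    left′ m = trans (left m) (+-congˡ (sym (x-0≈x _)))

  module Gaussian (q : Carrier) where

    -- gaussian n m is the Gaussian polynomial [n + m, n]_q.
    gaussian : ℕ → ℕ → Carrier
    gaussian zero    m       = 1#
    gaussian (suc n) zero    = 1#
    gaussian (suc n) (suc m) = gaussian n (suc m) + pow q (suc n) * gaussian (suc n) m

    gaussian-zeroʳ : ∀ n → gaussian n 0 ≈ 1#
    gaussian-zeroʳ zero    = refl
    gaussian-zeroʳ (suc n) = refl

    gaussian-poch : ∀ n m → gaussian n m * poch q q n * poch q q m ≈ poch q q (n ℕ.+ m)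
    gaussian-poch zero    m       = trans (*-congʳ (*-identityˡ 1#)) (*-identityˡ _)
    gaussian-poch (suc n) zero    = begin
      1# * poch q q (suc n) * 1#  ≈⟨ trans (*-identityʳ _) (*-identityˡ _) ⟩
      poch q q (suc n)            ≡⟨ ≡.cong (poch q q) (ℕₚ.+-identityʳ (suc n)) ⟨
      poch q q (suc n ℕ.+ 0)      ∎
    gaussian-poch (suc n) (suc m) = begin
      (g₀ + x * q * g₁) * (Pₙ * (1# - q * x)) * (Pₘ * (1# - q * y))
        ≈⟨ solve 7 (λ g₀ g₁ Pₙ Pₘ x y q →
             (g₀ :+ x :* q :* g₁) :* (Pₙ :* (:1 :- q :* x)) :* (Pₘ :* (:1 :- q :* y))
             := g₀ :* Pₙ :* (Pₘ :* (:1 :- q :* y)) :* (:1 :- q :* x)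
                :+ x :* q :* (:1 :- q :* y) :* (g₁ :* (Pₙ :* (:1 :- q :* x)) :* Pₘ))
           refl g₀ g₁ Pₙ Pₘ x y q ⟩
      g₀ * Pₙ * (Pₘ * (1# - q * y)) * (1# - q * x) + x * q * (1# - q * y) * (g₁ * (Pₙ * (1# - q * x)) * Pₘ)
        ≈⟨ +-cong (*-congʳ (gaussian-poch n (suc m))) (*-congˡ (gaussian-poch (suc n) m)) ⟩
      P (n ℕ.+ suc m) * (1# - q * x) + x * q * (1# - q * y) * P (suc n ℕ.+ m)
        ≡⟨ ≡.cong (λ k → P (n ℕ.+ suc m) * (1# - q * x) + x * q * (1# - q * y) * P k) (ℕₚ.+-suc n m) ⟨
      W * (1# - q * x) + x * q * (1# - q * y) * W
        ≈⟨ solve 4 (λ W x y q → W :* (:1 :- q :* x) :+ x :* q :* (:1 :- q :* y) :* W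
                                := W :* (:1 :- q :* (x :* (y :* q)))) refl W x y q ⟩
      W * (1# - q * (x * (y * q)))
        ≈⟨ *-congˡ (+-congˡ (-‿cong (*-congˡ (pow-+ q n (suc m))))) ⟨
      P (suc n ℕ.+ suc m)
        ∎
      where
      P : ℕ → Carrier
      P = poch q q
      g₀ = gaussian n (suc m)
      g₁ = gaussian (suc n) m
      Pₙ = P n
      Pₘ = P m
      x = pow q n
      y = pow q m
      W = P (n ℕ.+ suc m)

    gaussian-swap : (∀ k → ¬ (poch q q k ≈ 0#)) → ∀ n m →
      gaussian n (suc m) * (1# - pow q (suc m)) ≈ gaussian (suc n) m * (1# - pow q (suc n))
    gaussian-swap hq n m = *-cancelʳ Pₙ (hq n) (*-cancelʳ Pₘ (hq m) (begin
      g₀ * (1# - y * q) * Pₙ * Pₘ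
        ≈⟨ solve 5 (λ g₀ y q Pₙ Pₘ →
                     g₀ :* (:1 :- y :* q) :* Pₙ :* Pₘ := g₀ :* Pₙ :* (Pₘ :* (:1 :- q :* y)))
                   refl g₀ y q Pₙ Pₘ ⟩
      g₀ * Pₙ * poch q q (suc m)  ≈⟨ gaussian-poch n (suc m) ⟩
      poch q q (n ℕ.+ suc m)      ≡⟨ ≡.cong (poch q q) (ℕₚ.+-suc n m) ⟩
      poch q q (suc n ℕ.+ m)      ≈⟨ gaussian-poch (suc n) m ⟨
      g₁ * poch q q (suc n) * Pₘ
        ≈⟨ solve 5 (λ g₁ x q Pₙ Pₘ →
                     g₁ :* (Pₙ :* (:1 :- q :* x)) :* Pₘ := g₁ :* (:1 :- x :* q) :* Pₙ :* Pₘ)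
                   refl g₁ x q Pₙ Pₘ ⟩
      g₁ * (1# - x * q) * Pₙ * Pₘ ∎))
      where
      g₀ = gaussian n (suc m)
      g₁ = gaussian (suc n) m
      Pₙ = poch q q n
      Pₘ = poch q q m
      x = pow q n
      y = pow q m

    gaussian-qbinom : (hq : ∀ k → ¬ (poch q q k ≈ 0#)) → ∀ {N n} → n ≤ N →
      qbinom q hq N n ≈ gaussian n (N ∸ n)
    gaussian-qbinom hq {N} {n} n≤N with n ≤? N
    ... | no n≰N = ⊥-elim (n≰N n≤N)
    ... | yes _  = begin
      P N * Iₙ * Iₘ            ≡⟨ ≡.cong (λ k → P k * Iₙ * Iₘ) (ℕₚ.m+[n∸m]≡n n≤N) ⟨
      P (n ℕ.+ m) * Iₙ * Iₘ    ≈⟨ *-congʳ (*-congʳ (gaussian-poch n m)) ⟨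
      g * P n * P m * Iₙ * Iₘ  ≈⟨ *-congʳ (*-congʳ (xy∙z≈xz∙y g (P n) (P m))) ⟩
      g * P m * P n * Iₙ * Iₘ  ≈⟨ *-congʳ (*-inv-cancelʳ (g * P m) (P n) (hq n)) ⟩
      g * P m * Iₘ             ≈⟨ *-inv-cancelʳ g (P m) (hq m) ⟩
      g                        ∎
      where
      P : ℕ → Carrier
      P = poch q q
      m = N ∸ n
      g = gaussian n m
      Iₙ = inv (P n) (hq n)
      Iₘ = inv (P m) (hq m)

  module Certificate (q c b e : Carrier) where
    open Gaussian q

    -- weight n = (b/c;q)_n (q/e;q)_n (ce)^n with the powers of c and e absorbed into the factors.
    weight : ℕ → Carrier
    weight zero    = 1#
    weight (suc n) = weight n * ((c - b * pow q n) * (e - pow q n * q))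

    summand : ℕ → ℕ → Carrier
    summand n m = gaussian n m * poch q (c * e) m * poch q (b * q * pow q n) m * weight n

    certificate : ℕ → ℕ → Carrier
    certificate n m =
      - (pow q m * gaussian n m * poch q (c * e) m * poch q (b * q * pow q n) m * weight (suc n))

    ratio : ℕ → Carrier
    ratio N = (1# - c * q * pow q N) * (1# - b * e * pow q N)

    summand-left : ∀ m → summand 0 (suc m) ≈ ratio m * summand 0 m + certificate 0 m
    summand-left m = solve 7 (λ c b e q z P Q →
        :1 :* (P :* (:1 :- c :* e :* z)) :* (Q :* (:1 :- b :* q :* :1 :* z)) :* :1
        := (:1 :- c :* q :* z) :* (:1 :- b :* e :* z) :* (:1 :* P :* Q :* :1)
           :+ :- (z :* :1 :* P :* Q :* (:1 :* ((c :- b :* :1) :* (e :- :1 :* q)))))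
      refl c b e q (pow q m) (poch q (c * e) m) (poch q (b * q * 1#) m)

    summand-right : ∀ n → summand (suc n) 0 ≈ - certificate n 0
    summand-right n = begin
      1# * 1# * 1# * A
        ≈⟨ solve 1 (λ A → :1 :* :1 :* :1 :* A := :- (:- (:1 :* :1 :* :1 :* :1 :* A))) refl A ⟩
      - - (1# * 1# * 1# * 1# * A)
        ≈⟨ -‿cong (-‿cong (*-congʳ (*-congʳ (*-congʳ (*-congˡ (gaussian-zeroʳ n)))))) ⟨
      - certificate n 0
        ∎
      where A = weight (suc n)

    summand-interior : (∀ k → ¬ (poch q q k ≈ 0#)) → ∀ n m →
      summand (suc n) (suc m)
        ≈ ratio (suc (n ℕ.+ m)) * summand (suc n) m + (certificate (suc n) m - certificate n (suc m))
    summand-interior hq n m = begin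
      summand (suc n) (suc m)
        -- the certificate identity holds up to a multiple of the defect of gaussian-swap
        ≈⟨ solve 11 (λ b c e q x y g₀ g₁ P Q A →
             (g₀ :+ x :* q :* g₁) :* (P :* (:1 :- c :* e :* y)) :* (Q :* (:1 :- b :* q :* (x :* q) :* y)) :* A
             := (:1 :- c :* q :* (x :* y :* q)) :* (:1 :- b :* e :* (x :* y :* q)) :* (g₁ :* P :* Q :* A)
                :+ (:- (y :* g₁ :* P :* Q :* (A :* ((c :- b :* (x :* q)) :* (e :- x :* q :* q))))
                    :- :- (y :* q :* g₀ :* (P :* (:1 :- c :* e :* y)) :* ((:1 :- b :* q :* x) :* Q) :* A))
                :+ (:1 :- c :* e :* y) :* P :* Q :* A :* (g₀ :* (:1 :- y :* q) :- g₁ :* (:1 :- x :* q)))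
             refl b c e q x y g₀ g₁ P Q A ⟩
      ρ′ * summand (suc n) m + (certificate (suc n) m - H′) + K * (g₀ * (1# - y * q) - g₁ * (1# - x * q))
        ≈⟨ +-congˡ (*-congˡ (x≈y⇒x∙y⁻¹≈ε (gaussian-swap hq n m))) ⟩
      ρ′ * summand (suc n) m + (certificate (suc n) m - H′) + K * 0#
        ≈⟨ trans (+-congˡ (zeroʳ K)) (+-identityʳ _) ⟩
      ρ′ * summand (suc n) m + (certificate (suc n) m - H′)
        ≈⟨ +-cong (*-congʳ ρ′≈ratio) (+-congˡ (-‿cong H′≈certificate)) ⟩
      ratio (suc (n ℕ.+ m)) * summand (suc n) m + (certificate (suc n) m - certificate n (suc m))
        ∎
      where
      x = pow q n
      y = pow q m
      g₀ = gaussian n (suc m)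
      g₁ = gaussian (suc n) m
      P = poch q (c * e) m
      Q = poch q (b * q * pow q (suc n)) m
      A = weight (suc n)
      K = (1# - c * e * y) * P * Q * A
      ρ′ = (1# - c * q * (x * y * q)) * (1# - b * e * (x * y * q))
      H′ = - (y * q * g₀ * (P * (1# - c * e * y)) * ((1# - b * q * x) * Q) * A)
      qⁿqᵐq : x * y * q ≈ pow q (suc (n ℕ.+ m))
      qⁿqᵐq = *-congʳ (sym (pow-+ q n m))
      ρ′≈ratio : ρ′ ≈ ratio (suc (n ℕ.+ m))
      ρ′≈ratio = *-cong (+-congˡ (-‿cong (*-congˡ qⁿqᵐq))) (+-congˡ (-‿cong (*-congˡ qⁿqᵐq)))
      H′≈certificate : H′ ≈ certificate n (suc m)
      H′≈certificate = -‿cong (*-congʳ (*-congˡ (sym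
        (trans (poch-suc q (b * q * x) m) (*-congˡ (poch-cong q m (*-assoc _ _ _)))))))

    sumAntidiagonal-summand : (∀ k → ¬ (poch q q k ≈ 0#)) → ∀ N →
      sumAntidiagonal N summand ≈ poch q (c * q) N * poch q (b * e) N
    sumAntidiagonal-summand hq zero    = solve 0 (:1 :* :1 :* :1 :* :1 :+ con (+ 0) := :1 :* :1) refl
    sumAntidiagonal-summand hq (suc N) = begin
      sumAntidiagonal (suc N) summand
        ≈⟨ sumAntidiagonal-recurrence summand certificate ratio
             summand-left summand-right (summand-interior hq) N ⟩
      ratio N * sumAntidiagonal N summand
        ≈⟨ *-congˡ (sumAntidiagonal-summand hq N) ⟩
      ratio N * (X * Y)
        ≈⟨ solve 7 (λ c b e q z X Y → (:1 :- c :* q :* z) :* (:1 :- b :* e :* z) :* (X :* Y)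
                                     := X :* (:1 :- c :* q :* z) :* (Y :* (:1 :- b :* e :* z)))
                   refl c b e q (pow q N) X Y ⟩
      poch q (c * q) (suc N) * poch q (b * e) (suc N)
        ∎
      where
      X = poch q (c * q) N
      Y = poch q (b * e) N

  module Specialisation (q a b e : Carrier) (ha : ¬ (a ≈ 0#)) (he : ¬ (e ≈ 0#)) where
    open Gaussian q
    open Certificate q (- a) b e public

    weight-as-poch : ∀ n →
      pow (- 1#) n * poch q (- (b * inv a ha)) n * poch q (q * inv e he) n * pow (a * e) n ≈ weight n
    weight-as-poch zero    = trans (*-identityʳ _) (trans (*-identityʳ _) (*-identityʳ _))
    weight-as-poch (suc n) = begin
      s * - 1# * (P₁ * (1# - - (b * a⁻¹) * x)) * (P₂ * (1# - q * e⁻¹ * x)) * (p * (a * e))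
        ≈⟨ solve 11 (λ s P₁ P₂ p a b e q x a⁻¹ e⁻¹ →
             s :* :- :1 :* (P₁ :* (:1 :- :- (b :* a⁻¹) :* x)) :* (P₂ :* (:1 :- q :* e⁻¹ :* x)) :* (p :* (a :* e))
             := s :* P₁ :* P₂ :* p :* ((:- a :- b :* x :* (a :* a⁻¹)) :* (e :- x :* q :* (e :* e⁻¹))))
           refl s P₁ P₂ p a b e q x a⁻¹ e⁻¹ ⟩
      s * P₁ * P₂ * p * ((- a - b * x * (a * a⁻¹)) * (e - x * q * (e * e⁻¹)))
        ≈⟨ *-cong (weight-as-poch n)
                  (*-cong (+-congˡ (-‿cong (cancel a ha))) (+-congˡ (-‿cong (cancel e he)))) ⟩
      weight n * ((- a - b * x) * (e - x * q))
        ∎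
      where
      s = pow (- 1#) n
      P₁ = poch q (- (b * inv a ha)) n
      P₂ = poch q (q * inv e he) n
      p = pow (a * e) n
      x = pow q n
      a⁻¹ = inv a ha
      e⁻¹ = inv e he
      cancel : ∀ {y} z (z≉0 : ¬ (z ≈ 0#)) → y * (z * inv z z≉0) ≈ y
      cancel z z≉0 = trans (*-congˡ (inv-inverse z z≉0)) (*-identityʳ _)

    poch-product-as-sum : (∀ k → ¬ (poch q q k ≈ 0#)) → ∀ N →
      poch q (- (a * q)) N * poch q (b * e) N ≈ sumAntidiagonal N summand
    poch-product-as-sum hq N = begin
      poch q (- (a * q)) N * poch q (b * e) N  ≈⟨ *-congʳ (poch-cong q N (-‿distribˡ-* a q)) ⟩
      poch q (- a * q) N * poch q (b * e) N    ≈⟨ sumAntidiagonal-summand hq N ⟨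
      sumAntidiagonal N summand                ∎

    term-as-summand : (hq : ∀ k → ¬ (poch q q k ≈ 0#)) → ∀ {N k} → k ≤ N →
      (pₖ : ¬ (poch q (b * q) k ≈ 0#)) (p_N : ¬ (poch q (b * q) N ≈ 0#)) →
      qbinom q hq N k * pow (- 1#) k * poch q (- (a * e)) (N ∸ k) * poch q (- (b * inv a ha)) k
        * poch q (q * inv e he) k * pow (a * e) k * inv (poch q (b * q) k) pₖ
      ≈ summand k (N ∸ k) * inv (poch q (b * q) N) p_N
    term-as-summand hq {N} {k} k≤N pₖ p_N = begin
      Q * s * P₀ * P₁ * P₂ * p * I
        ≈⟨ solve 7 (λ Q s P₀ P₁ P₂ p I →
                     Q :* s :* P₀ :* P₁ :* P₂ :* p :* I := Q :* P₀ :* (s :* P₁ :* P₂ :* p) :* I)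
                   refl Q s P₀ P₁ P₂ p I ⟩
      Q * P₀ * (s * P₁ * P₂ * p) * I
        ≈⟨ *-cong (*-cong (*-cong (gaussian-qbinom hq k≤N) (poch-cong q m (-‿distribˡ-* a e)))
                          (weight-as-poch k))
                  (inv-factor pₖ p_N poch-split) ⟩
      gaussian k m * poch q (- a * e) m * weight k * (R * inv (poch q (b * q) N) p_N)
        ≈⟨ solve 5 (λ g P w R I → g :* P :* w :* (R :* I) := g :* P :* R :* w :* I)
                   refl (gaussian k m) (poch q (- a * e) m) (weight k) R (inv (poch q (b * q) N) p_N) ⟩
      summand k m * inv (poch q (b * q) N) p_N
        ∎
      where
      m = N ∸ k
      Q = qbinom q hq N k
      s = pow (- 1#) k
      P₀ = poch q (- (a * e)) m
      P₁ = poch q (- (b * inv a ha)) k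
      P₂ = poch q (q * inv e he) k
      p = pow (a * e) k
      I = inv (poch q (b * q) k) pₖ
      R = poch q (b * q * pow q k) m
      poch-split : poch q (b * q) N ≈ poch q (b * q) k * R
      poch-split = begin
        poch q (b * q) N            ≡⟨ ≡.cong (poch q (b * q)) (ℕₚ.m+[n∸m]≡n k≤N) ⟨
        poch q (b * q) (k ℕ.+ m)    ≈⟨ poch-+ q (b * q) k m ⟩
        poch q (b * q) k * R        ∎

theorem5p2 : ∀ {c ℓ : Level} (F : Field c ℓ) → let open Field F in let open FieldOps F in
    (q a b e : Carrier) →
    (hq : ∀ k → ¬ (poch q q k ≈ 0#)) →
    (ha : ¬ (a ≈ 0#)) → (he : ¬ (e ≈ 0#)) →
    (N : ℕ) → (hb : ∀ n → n ≤ N → ¬ (poch q (b * q) n ≈ 0#)) →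
    poch q (- (a * q)) N * poch q (b * e) N * inv (poch q (b * q) N) (hb N ≤-refl)
      ≈ sumFin (suc N) (λ i →
          qbinom q hq N (toℕ i)
          * pow (- 1#) (toℕ i)
          * poch q (- (a * e)) (N ∸ toℕ i)
          * poch q (- (b * inv a ha)) (toℕ i)
          * poch q (q * inv e he) (toℕ i)
          * pow (a * e) (toℕ i)
          * inv (poch q (b * q) (toℕ i)) (hb (toℕ i) (toℕ≤pred[n] i)))
theorem5p2 F q a b e hq ha he N hb = begin
    poch q (- (a * q)) N * poch q (b * e) N * I
      ≈⟨ *-congʳ (poch-product-as-sum hq N) ⟩
    sumAntidiagonal N summand * I
      ≈⟨ sumFin-distribʳ (suc N) (λ i → summand (toℕ i) (N ∸ toℕ i)) I ⟩
    sumFin (suc N) (λ i → summand (toℕ i) (N ∸ toℕ i) * I)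
      ≈⟨ sumFin-cong (suc N) (λ i → term-as-summand hq (i≤N i) (hb (toℕ i) (i≤N i)) (hb N ≤-refl)) ⟨
    _
      ∎
  where
  open Field F
  open FieldOps F
  open QSeries F
  open Specialisation q a b e ha he
  open import Relation.Binary.Reasoning.Setoid setoid
  I = inv (poch q (b * q) N) (hb N ≤-refl)
  i≤N : (i : Fin (suc N)) → toℕ i ≤ N
  i≤N = toℕ≤pred[n]
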